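{- Let $G$ be a bipartite graph with at least one perfect matching and positive integer edge weights $\Phi(e)$. Then $$\Phi(G)\ \ge\ \Phi_E(G)-|V(G)|+\mathrm{scc}(G)+1,$$ where $\mathrm{scc}(G)$ is the number of connected components of $G\setminus b^-(G)$.
   Context: $b^-(G)$ is the set of edges of $G$ contained in no perfect matching of $G$; $G^b=G\setminus b^-(G)$ is obtained by deleting these edges (keeping all vertices). $\Phi_E(G)=\sum_{e\in E(G^b)}\Phi(e)$. For a connected component $K$ of $G^b$, $\Phi(K)=\sum_{e\in E(K)}\Phi(e)-|V(K)|+2$, and the potential $\Phi(G)$ is the product of $\Phi(K)$ over all connected components $K$ of $G^b$. -}

module Defs where

open import Data.Nat as ℕ using (ℕ; zero; suc)
open import Data.Integer as ℤ using (ℤ)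
open import Data.Bool using (Bool; true; false; if_then_else_)
open import Data.Fin using (Fin; zero; suc)
open import Data.Fin.Properties using (all?) renaming (_≟_ to _≟ᶠ_)
open import Data.Fin.Subset using (Subset; _∈_)
open import Data.Fin.Subset.Properties using (_∈?_; anySubset?)
open import Data.Product using (Σ; _×_; _,_; ∃)
open import Data.Sum using (_⊎_)
open import Function.Definitions using (Injective)
open import Relation.Nullary using (Dec; ¬_)
open import Relation.Nullary.Decidable using (⌊_⌋; _⊎-dec_; _×-dec_)
open import Relation.Binary.PropositionalEquality using (_≡_)
open import Relation.Binary.Construct.Closure.ReflexiveTransitive using (Star)

∑ : (k : ℕ) → (Fin k → ℤ) → ℤ
∑ zero    f = ℤ.0ℤ
∑ (suc k) f = f zero ℤ.+ ∑ k (λ i → f (suc i))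

∏ : (k : ℕ) → (Fin k → ℤ) → ℤ
∏ zero    f = ℤ.1ℤ
∏ (suc k) f = f zero ℤ.* ∏ k (λ i → f (suc i))

record BipGraph (n m : ℕ) : Set where
  field
    colour   : Fin n → Bool
    left     : Fin m → Fin n
    right    : Fin m → Fin n
    left-col  : ∀ e → colour (left e) ≡ false
    right-col : ∀ e → colour (right e) ≡ true
    simple   : ∀ e e′ → left e ≡ left e′ → right e ≡ right e′ → e ≡ e′

module _ {n m : ℕ} (G : BipGraph n m) where
  open BipGraph G

  Incident : Fin m → Fin n → Set
  Incident e v = (left e ≡ v) ⊎ (right e ≡ v)

  incident? : ∀ e v → Dec (Incident e v)
  incident? e v = (left e ≟ᶠ v) ⊎-dec (right e ≟ᶠ v)

  degIn : Subset m → Fin n → ℤ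
  degIn M v = ∑ m (λ e → if ⌊ e ∈? M ⌋ then (if ⌊ incident? e v ⌋ then ℤ.1ℤ else ℤ.0ℤ) else ℤ.0ℤ)

  IsPerfectMatching : Subset m → Set
  IsPerfectMatching M = ∀ v → degIn M v ≡ ℤ.1ℤ

  isPM? : ∀ M → Dec (IsPerfectMatching M)
  isPM? M = all? (λ v → degIn M v ℤ.≟ ℤ.1ℤ)

  HasPerfectMatching : Set
  HasPerfectMatching = ∃ IsPerfectMatching

  -- e lies in some perfect matching, i.e. e ∉ b⁻(G), i.e. e is an edge of G^b
  Allowed : Fin m → Set
  Allowed e = ∃ λ M → IsPerfectMatching M × e ∈ M

  allowed? : ∀ e → Dec (Allowed e)
  allowed? e = anySubset? (λ M → isPM? M ×-dec (e ∈? M))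

  allowed : Fin m → Bool
  allowed e = ⌊ allowed? e ⌋

  -- adjacency in G^b = G ∖ b⁻(G)  (all vertices kept)
  AdjB : Fin n → Fin n → Set
  AdjB u v = ∃ λ e → Allowed e × Incident e u × Incident e v

  ConnB : Fin n → Fin n → Set
  ConnB = Star AdjB

  record Components (k : ℕ) (comp : Fin n → Fin k) : Set where
    field
      surjective : ∀ i → ∃ λ v → comp v ≡ i
      sound      : ∀ u v → comp u ≡ comp v → ConnB u v
      complete   : ∀ u v → ConnB u v → comp u ≡ comp v

  module _ (Φ : Fin m → ℕ) where
    ΦE : ℤ
    ΦE = ∑ m (λ e → if allowed e then ℤ.+ Φ e else ℤ.0ℤ)

    ΦK : {k : ℕ} → (Fin n → Fin k) → Fin k → ℤ
    ΦK comp i =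
      ∑ m (λ e → if allowed e then (if ⌊ comp (left e) ≟ᶠ i ⌋ then ℤ.+ Φ e else ℤ.0ℤ) else ℤ.0ℤ)
      ℤ.- ∑ n (λ v → if ⌊ comp v ≟ᶠ i ⌋ then ℤ.1ℤ else ℤ.0ℤ)
      ℤ.+ ℤ.+ 2

    ΦG : (k : ℕ) → (Fin n → Fin k) → ℤ
    ΦG k comp = ∏ k (ΦK comp)

-- Fix a perfect matching M; its edges are allowed, so it covers every component K of G^b.
-- Either some vertex r of K has its M-edge as its only allowed edge, and then K is that
-- single edge; or every vertex of K has an allowed edge outside M, and sending each right
-- vertex to such an edge ending at it and each left vertex to its M-edge is injective.
-- Hence |V(K)| ≤ |E(K)| + 1 ≤ Φ(E(K)) + 1, i.e. Φ(K) ≥ 1. For factors fᵢ ≥ 1 one has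
-- ∏ fᵢ ≥ 1 + ∑ (fᵢ - 1), and ∑ (Φ(K) - 1) = Φ_E(G) - |V(G)| + scc(G).
module Submission where

open import Defs
open import Level using (Level)
open import Data.Nat as ℕ using (ℕ; zero; suc; z≤n; s≤s; _<_)
import Data.Nat.Properties as ℕP
open import Data.Integer as ℤ using (ℤ; _≤_; _+_; _-_; +_; _*_; -_; +≤+; 0ℤ; 1ℤ)
import Data.Integer.Properties as ℤP
open import Data.Integer.Tactic.RingSolver using (solve-∀)
open import Data.Bool using (Bool; true; false; if_then_else_)
open import Data.Fin using (Fin; zero; suc)
open import Data.Fin.Properties using (any?; suc-injective; 0≢1+n) renaming (_≟_ to _≟ᶠ_)
open import Data.Fin.Subset using (Subset; _∈_; _∉_)
open import Data.Fin.Subset.Properties using (_∈?_)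
open import Data.Product using (_×_; _,_; ∃; proj₁; proj₂)
open import Data.Sum using (inj₁; inj₂)
open import Function using (_∘_)
open import Relation.Nullary using (Dec; yes; no; ¬_; ¬?; contradiction)
open import Relation.Nullary.Decidable using (⌊_⌋; _×-dec_; ⌊⌋-map′; decidable-stable)
open import Relation.Unary using (Pred; Decidable; _≐_; U)
open import Relation.Unary.Properties using (U?)
open import Relation.Binary.PropositionalEquality
open import Relation.Binary.Construct.Closure.ReflexiveTransitive using (ε; _◅_)
open import Algebra.Properties.CommutativeMonoid.Sum ℤP.+-0-commutativeMonoid as Sum using (sum)

private
  variable
    ℓ ℓ′ : Level

∑≡sum : ∀ k (f : Fin k → ℤ) → ∑ k f ≡ sum f
∑≡sum zero    f = refl
∑≡sum (suc k) f = cong (λ s → f zero + s) (∑≡sum k (f ∘ suc))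

∑-cong : ∀ k {f g : Fin k → ℤ} → (∀ i → f i ≡ g i) → ∑ k f ≡ ∑ k g
∑-cong k {f} {g} f≗g rewrite ∑≡sum k f | ∑≡sum k g = Sum.sum-cong-≗ f≗g

∑-distrib-+ : ∀ k (f g : Fin k → ℤ) → ∑ k (λ i → f i + g i) ≡ ∑ k f + ∑ k g
∑-distrib-+ k f g rewrite ∑≡sum k f | ∑≡sum k g | ∑≡sum k (λ i → f i + g i) = Sum.∑-distrib-+ f g

∑-comm : ∀ k n (f : Fin k → Fin n → ℤ) → ∑ k (λ i → ∑ n (f i)) ≡ ∑ n (λ j → ∑ k (λ i → f i j))
∑-comm k n f = begin
  ∑ k (λ i → ∑ n (f i))          ≡⟨ ∑-cong k (λ i → ∑≡sum n (f i)) ⟩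
  ∑ k (λ i → sum (f i))          ≡⟨ ∑≡sum k _ ⟩
  sum (λ i → sum (f i))          ≡⟨ Sum.∑-comm f ⟩
  sum (λ j → sum (λ i → f i j))  ≡⟨ ∑≡sum n _ ⟨
  ∑ n (λ j → sum (λ i → f i j))  ≡⟨ ∑-cong n (λ j → ∑≡sum k (λ i → f i j)) ⟨
  ∑ n (λ j → ∑ k (λ i → f i j))  ∎
  where open ≡-Reasoning

∑-zero : ∀ k → ∑ k (λ _ → 0ℤ) ≡ 0ℤ
∑-zero k = trans (∑≡sum k _) (Sum.sum-replicate-zero k)

∑-one : ∀ k → ∑ k (λ _ → 1ℤ) ≡ + k
∑-one zero    = refl
∑-one (suc k) = cong (λ s → 1ℤ + s) (∑-one k)

∑-neg : ∀ k (f : Fin k → ℤ) → ∑ k (λ i → - f i) ≡ - ∑ k f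
∑-neg zero    f = refl
∑-neg (suc k) f = trans (cong (λ s → - f zero + s) (∑-neg k (f ∘ suc)))
                        (sym (ℤP.neg-distrib-+ (f zero) _))

∑-mono-≤ : ∀ k {f g : Fin k → ℤ} → (∀ i → f i ≤ g i) → ∑ k f ≤ ∑ k g
∑-mono-≤ zero    f≤g = ℤP.≤-refl
∑-mono-≤ (suc k) f≤g = ℤP.+-mono-≤ (f≤g zero) (∑-mono-≤ k (f≤g ∘ suc))

∑-nonneg : ∀ k {f : Fin k → ℤ} → (∀ i → 0ℤ ≤ f i) → 0ℤ ≤ ∑ k f
∑-nonneg k {f} 0≤f = subst (_≤ ∑ k f) (∑-zero k) (∑-mono-≤ k 0≤f)

∑-δ : ∀ k (c : Fin k) (x : ℤ) → ∑ k (λ i → if ⌊ c ≟ᶠ i ⌋ then x else 0ℤ) ≡ x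
∑-δ (suc k) zero    x = trans (cong (λ s → x + s) (∑-zero k)) (ℤP.+-identityʳ x)
∑-δ (suc k) (suc c) x = trans (cong (λ s → 0ℤ + s) (trans (∑-cong k suc-≟) (∑-δ k c x))) (ℤP.+-identityˡ x)
  where
  suc-≟ : ∀ i → (if ⌊ suc c ≟ᶠ suc i ⌋ then x else 0ℤ) ≡ (if ⌊ c ≟ᶠ i ⌋ then x else 0ℤ)
  suc-≟ i = cong (if_then x else 0ℤ) (⌊⌋-map′ (cong suc) suc-injective (c ≟ᶠ i))

∑-pred≤∏ : ∀ k (f : Fin k → ℤ) → (∀ i → 1ℤ ≤ f i) → ∑ k (λ i → f i - 1ℤ) + 1ℤ ≤ ∏ k f
∑-pred≤∏ zero    f 1≤f = ℤP.≤-refl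
∑-pred≤∏ (suc k) f 1≤f =
  ℤP.0≤i-j⇒j≤i (subst (0ℤ ≤_) (sym (expand x p s)) (ℤP.+-mono-≤ 0≤[x-1][p-1] (ℤP.i≤j⇒0≤j-i s+1≤p)))
  where
  x = f zero
  p = ∏ k (f ∘ suc)
  s = ∑ k (λ i → f (suc i) - 1ℤ)
  s+1≤p : s + 1ℤ ≤ p
  s+1≤p = ∑-pred≤∏ k (f ∘ suc) (1≤f ∘ suc)
  0≤x-1 : 0ℤ ≤ x - 1ℤ
  0≤x-1 = ℤP.i≤j⇒0≤j-i (1≤f zero)
  0≤p-1 : 0ℤ ≤ p - 1ℤ
  0≤p-1 = ℤP.i≤j⇒0≤j-i (ℤP.≤-trans (ℤP.+-monoˡ-≤ 1ℤ (∑-nonneg k (λ i → ℤP.i≤j⇒0≤j-i (1≤f (suc i))))) s+1≤p)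
  0≤[x-1][p-1] : 0ℤ ≤ (x - 1ℤ) * (p - 1ℤ)
  0≤[x-1][p-1] = ℤP.*-monoʳ-≤-nonNeg (p - 1ℤ) {{ℤ.nonNegative 0≤p-1}} 0≤x-1
  expand : ∀ x p s → x * p - ((x - 1ℤ) + s + 1ℤ) ≡ (x - 1ℤ) * (p - 1ℤ) + (p - (s + 1ℤ))
  expand = solve-∀

iverson : ∀ {a} {A : Set a} → Dec A → ℤ
iverson a? = if ⌊ a? ⌋ then 1ℤ else 0ℤ

count : ∀ {n} {P : Pred (Fin n) ℓ} → Decidable P → ℕ
count {n = zero}  _  = 0
count {n = suc n} P? = (if ⌊ P? zero ⌋ then 1 else 0) ℕ.+ count (P? ∘ suc)

∑-iverson≡count : ∀ k {P : Pred (Fin k) ℓ} (P? : Decidable P) → ∑ k (iverson ∘ P?) ≡ + count P?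
∑-iverson≡count zero    P? = refl
∑-iverson≡count (suc k) P? with P? zero
... | yes _ = trans (cong (λ s → 1ℤ + s) (∑-iverson≡count k (P? ∘ suc))) (sym (ℤP.pos-+ 1 _))
... | no _  = trans (ℤP.+-identityˡ _) (∑-iverson≡count k (P? ∘ suc))

count-cong : ∀ {n} {P : Pred (Fin n) ℓ} {Q : Pred (Fin n) ℓ′} (P? : Decidable P) (Q? : Decidable Q) →
             P ≐ Q → count P? ≡ count Q?
count-cong {n = zero}  P? Q? P≐Q = refl
count-cong {n = suc n} P? Q? (P⊆Q , Q⊆P) with P? zero | Q? zero
... | yes _  | yes _ = cong suc (count-cong (P? ∘ suc) (Q? ∘ suc) (P⊆Q , Q⊆P))
... | no _   | no _  = count-cong (P? ∘ suc) (Q? ∘ suc) (P⊆Q , Q⊆P)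
... | yes p  | no ¬q = contradiction (P⊆Q p) ¬q
... | no ¬p  | yes q = contradiction (Q⊆P q) ¬p

_─_ : ∀ {n} → Pred (Fin n) ℓ → Fin n → Pred (Fin n) ℓ
(P ─ j) i = P i × i ≢ j

_─?_ : ∀ {n} {P : Pred (Fin n) ℓ} → Decidable P → (j : Fin n) → Decidable (P ─ j)
(P? ─? j) i = P? i ×-dec ¬? (i ≟ᶠ j)

count-─-suc : ∀ {n} {P : Pred (Fin (suc n)) ℓ} (P? : Decidable P) (j : Fin n) →
              count ((P? ∘ suc) ─? j) ≡ count ((P? ─? suc j) ∘ suc)
count-─-suc P? j = count-cong ((P? ∘ suc) ─? j) ((P? ─? suc j) ∘ suc)
  ((λ (p , i≢j) → p , i≢j ∘ suc-injective) , (λ (p , 1+i≢1+j) → p , 1+i≢1+j ∘ cong suc))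

count-remove : ∀ {n} {P : Pred (Fin n) ℓ} (P? : Decidable P) {j : Fin n} → P j →
               count P? ≡ suc (count (P? ─? j))
count-remove {n = suc n} P? {zero} p with P? zero
... | yes _ = cong suc (count-cong (P? ∘ suc) _ ((λ q → q , λ ()) , proj₁))
... | no ¬p = contradiction p ¬p
count-remove {n = suc n} P? {suc j} p with P? zero
... | yes _ = cong suc (trans (count-remove (P? ∘ suc) p) (cong suc (count-─-suc P? j)))
... | no _  = trans (count-remove (P? ∘ suc) p) (cong suc (count-─-suc P? j))

count-injection : ∀ {n k} {P : Pred (Fin n) ℓ} {Q : Pred (Fin k) ℓ′} (P? : Decidable P) (Q? : Decidable Q)
                  (f : ∀ {i} → P i → ∃ Q) →
                  (∀ {i j} (p : P i) (q : P j) → proj₁ (f p) ≡ proj₁ (f q) → i ≡ j) →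
                  count P? ℕ.≤ count Q?
count-injection {n = zero}  P? Q? f f-inj = z≤n
count-injection {n = suc n} {P = P} {Q = Q} P? Q? f f-inj with P? zero
... | no _   = count-injection (P? ∘ suc) Q? f (λ p q → suc-injective ∘ f-inj p q)
... | yes p₀ = subst (suc (count (P? ∘ suc)) ℕ.≤_) (sym (count-remove Q? (proj₂ (f p₀))))
                 (s≤s (count-injection (P? ∘ suc) (Q? ─? proj₁ (f p₀)) f′ (λ p q → suc-injective ∘ f-inj p q)))
  where
  f′ : ∀ {i} → P (suc i) → ∃ (Q ─ proj₁ (f p₀))
  f′ p = proj₁ (f p) , proj₂ (f p) , 0≢1+n ∘ sym ∘ f-inj p p₀

0<count⇒∃ : ∀ {n} {P : Pred (Fin n) ℓ} (P? : Decidable P) → 0 < count P? → ∃ P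
0<count⇒∃ {n = suc n} P? 0<c with P? zero
... | yes p = zero , p
... | no _  = let i , p = 0<count⇒∃ (P? ∘ suc) 0<c in suc i , p

-- Two distinct witnesses would give an injection of Fin 2 into P.
count≤1⇒unique : ∀ {n} {P : Pred (Fin n) ℓ} (P? : Decidable P) → count P? ℕ.≤ 1 →
                 ∀ {i j} → P i → P j → i ≡ j
count≤1⇒unique {P = P} P? c≤1 {i} {j} p q with i ≟ᶠ j
... | yes i≡j = i≡j
... | no i≢j  = contradiction (ℕP.≤-trans (count-injection U? P? (λ {x} → pair {x}) pair-injective) c≤1)
                              λ { (s≤s ()) }
  where
  pair : ∀ {x : Fin 2} → U x → ∃ P
  pair {zero}     _ = i , p
  pair {suc zero} _ = j , q
  pair-injective : ∀ {x y : Fin 2} (u : U x) (v : U y) → proj₁ (pair {x} u) ≡ proj₁ (pair {y} v) → x ≡ y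
  pair-injective {zero}     {zero}     _ _ _   = refl
  pair-injective {suc zero} {suc zero} _ _ _   = refl
  pair-injective {zero}     {suc zero} _ _ i≡j = contradiction i≡j i≢j
  pair-injective {suc zero} {zero}     _ _ j≡i = contradiction (sym j≡i) i≢j

if-⌊×-dec⌋ : ∀ {a b c} {A : Set a} {B : Set b} {X : Set c} (a? : Dec A) (b? : Dec B) (x y : X) →
             (if ⌊ a? ⌋ then (if ⌊ b? ⌋ then x else y) else y) ≡ (if ⌊ a? ×-dec b? ⌋ then x else y)
if-⌊×-dec⌋ (yes _) (yes _) x y = refl
if-⌊×-dec⌋ (yes _) (no _)  x y = refl
if-⌊×-dec⌋ (no _)  _       x y = refl

iverson≤ : ∀ {a} {A : Set a} (a? : Dec A) {x : ℤ} → 1ℤ ≤ x → iverson a? ≤ (if ⌊ a? ⌋ then x else 0ℤ)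
iverson≤ (yes _) 1≤x = 1≤x
iverson≤ (no _)  _   = ℤP.≤-refl

∑-guarded-δ : ∀ k (b : Bool) (c : Fin k) (x : ℤ) →
              ∑ k (λ i → if b then (if ⌊ c ≟ᶠ i ⌋ then x else 0ℤ) else 0ℤ) ≡ (if b then x else 0ℤ)
∑-guarded-δ k true  c x = ∑-δ k c x
∑-guarded-δ k false c x = ∑-zero k

1≤x-y+2 : ∀ {x y} → y ≤ 1ℤ + x → 1ℤ ≤ x - y + + 2
1≤x-y+2 {x} {y} y≤1+x = subst (1ℤ ≤_) (regroup x y) (ℤP.+-monoˡ-≤ 1ℤ (ℤP.i≤j⇒0≤j-i y≤1+x))
  where
  regroup : ∀ x y → (1ℤ + x - y) + 1ℤ ≡ x - y + + 2
  regroup = solve-∀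

module _ {n m : ℕ} (G : BipGraph n m) where
  open BipGraph G

  private
    variable
      v w : Fin n
      e e′ : Fin m
      M : Subset m

  incident-true⇒right : colour v ≡ true → Incident G e v → right e ≡ v
  incident-true⇒right {v} {e} c (inj₁ refl) = contradiction (trans (sym c) (left-col e)) λ ()
  incident-true⇒right c (inj₂ r) = r

  incident-false⇒left : colour v ≡ false → Incident G e v → left e ≡ v
  incident-false⇒left c (inj₁ l) = l
  incident-false⇒left {v} {e} c (inj₂ refl) = contradiction (trans (sym (right-col e)) c) λ ()

  MatchedAt : Subset m → Fin n → Pred (Fin m) _
  MatchedAt M v e = e ∈ M × Incident G e v

  matchedAt? : ∀ M v → Decidable (MatchedAt M v)
  matchedAt? M v e = (e ∈? M) ×-dec incident? G e v

  degIn≡count : ∀ M v → degIn G M v ≡ + count (matchedAt? M v)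
  degIn≡count M v = trans (∑-cong m (λ e → if-⌊×-dec⌋ (e ∈? M) (incident? G e v) 1ℤ 0ℤ))
                          (∑-iverson≡count m (matchedAt? M v))

  module _ (pm : IsPerfectMatching G M) where
    count-matchedAt≡1 : ∀ v → count (matchedAt? M v) ≡ 1
    count-matchedAt≡1 v = ℤP.+-injective (trans (sym (degIn≡count M v)) (pm v))

    matching-edge : ∀ v → ∃ (MatchedAt M v)
    matching-edge v = 0<count⇒∃ (matchedAt? M v) (ℕP.≤-reflexive (sym (count-matchedAt≡1 v)))

    matching-edge-unique : MatchedAt M v e → MatchedAt M v e′ → e ≡ e′
    matching-edge-unique {v} = count≤1⇒unique (matchedAt? M v) (ℕP.≤-reflexive (count-matchedAt≡1 v))

  SoleAllowedAt : Fin n → Fin m → Set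
  SoleAllowedAt v e = ∀ {e′} → Allowed G e′ → Incident G e′ v → e′ ≡ e

  -- A perfect matching through e′ must cover v, which only e can do; so it holds both e and e′ at w.
  sole-allowed-at-both-ends : SoleAllowedAt v e → Incident G e v → Incident G e w → SoleAllowedAt w e
  sole-allowed-at-both-ends {v} sole ev ew (M′ , pm′ , e′∈M′) e′w
    with matching-edge pm′ v
  ... | e″ , e″∈M′ , e″v with sole (M′ , pm′ , e″∈M′) e″v
  ...   | refl = matching-edge-unique pm′ (e′∈M′ , e′w) (e″∈M′ , ew)

  sole-allowed-conn⇒incident : SoleAllowedAt v e → Incident G e v → ConnB G v w → Incident G e w
  sole-allowed-conn⇒incident sole ev ε = ev
  sole-allowed-conn⇒incident sole ev ((e′ , a , e′v , e′u) ◅ path) with sole a e′v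
  ... | refl = sole-allowed-conn⇒incident (sole-allowed-at-both-ends sole ev e′u) e′u path

  UnmatchedAllowedAt : Subset m → Fin n → Pred (Fin m) _
  UnmatchedAllowedAt M v e = Allowed G e × e ∉ M × Incident G e v

  unmatchedAllowedAt? : ∀ M v → Decidable (UnmatchedAllowedAt M v)
  unmatchedAllowedAt? M v e = allowed? G e ×-dec (¬? (e ∈? M) ×-dec incident? G e v)

  no-unmatched⇒sole-allowed : IsPerfectMatching G M → ¬ ∃ (UnmatchedAllowedAt M v) → MatchedAt M v e → SoleAllowedAt v e
  no-unmatched⇒sole-allowed {M} pm none ev {e′} a e′v with e′ ∈? M
  ... | yes e′∈M = matching-edge-unique pm (e′∈M , e′v) ev
  ... | no e′∉M  = contradiction (e′ , a , e′∉M , e′v) none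

  data Represents (M : Subset m) (v : Fin n) (e : Fin m) : Set where
    unmatched-right : e ∉ M → right e ≡ v → Represents M v e
    matched-left    : e ∈ M → left e ≡ v → Represents M v e

  represents⇒incident : Represents M v e → Incident G e v
  represents⇒incident (unmatched-right _ r) = inj₂ r
  represents⇒incident (matched-left _ l)    = inj₁ l

  represents-injective : Represents M v e → Represents M w e → v ≡ w
  represents-injective (unmatched-right _ refl) (unmatched-right _ refl) = refl
  represents-injective (matched-left _ refl)    (matched-left _ refl)    = refl
  represents-injective (unmatched-right e∉M _)  (matched-left e∈M _)     = contradiction e∈M e∉M
  represents-injective (matched-left e∈M _)     (unmatched-right e∉M _)  = contradiction e∈M e∉M

  representative : IsPerfectMatching G M → ∃ (UnmatchedAllowedAt M v) →
                   ∃ λ e → Allowed G e × Represents M v e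
  representative {M} {v} pm (e , a , e∉M , ev) with colour v in c
  ... | true  = e , a , unmatched-right e∉M (incident-true⇒right c ev)
  ... | false = let e′ , e′∈M , e′v = matching-edge pm v
                in e′ , (M , pm , e′∈M) , matched-left e′∈M (incident-false⇒left c e′v)

  endpoint-index : Incident G e v → Fin 2
  endpoint-index (inj₁ _) = zero
  endpoint-index (inj₂ _) = suc zero

  endpoint-index-injective : (p : Incident G e v) (q : Incident G e w) →
                             endpoint-index p ≡ endpoint-index q → v ≡ w
  endpoint-index-injective (inj₁ refl) (inj₁ refl) _ = refl
  endpoint-index-injective (inj₂ refl) (inj₂ refl) _ = refl
  endpoint-index-injective (inj₁ _)    (inj₂ _)    ()
  endpoint-index-injective (inj₂ _)    (inj₁ _)    ()

  module _ {k} {comp : Fin n → Fin k} (C : Components G k comp) where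
    open Components C

    allowed⇒same-component : Allowed G e → Incident G e v → comp (left e) ≡ comp v
    allowed⇒same-component {e} a ev = complete _ _ ((e , a , inj₁ refl , ev) ◅ ε)

    inComponent? : ∀ i → Decidable (λ v → comp v ≡ i)
    inComponent? i v = comp v ≟ᶠ i

    ComponentEdge : Fin k → Pred (Fin m) _
    ComponentEdge i e = Allowed G e × comp (left e) ≡ i

    componentEdge? : ∀ i → Decidable (ComponentEdge i)
    componentEdge? i e = allowed? G e ×-dec (comp (left e) ≟ᶠ i)

    sole-allowed-component≤2 : ∀ {r i} → comp r ≡ i → SoleAllowedAt r e → Incident G e r →
                               count (inComponent? i) ℕ.≤ 2
    sole-allowed-component≤2 {e} {r} r∈i sole er =
      count-injection (inComponent? _) U? (λ v∈i → endpoint-index (reach v∈i) , _)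
                      (λ p q → endpoint-index-injective (reach p) (reach q))
      where
      reach : comp v ≡ _ → Incident G e v
      reach v∈i = sole-allowed-conn⇒incident sole er (sound r _ (trans r∈i (sym v∈i)))

    component≤edges : IsPerfectMatching G M → ∀ i → (∀ {v} → comp v ≡ i → ∃ (UnmatchedAllowedAt M v)) →
                      count (inComponent? i) ℕ.≤ count (componentEdge? i)
    component≤edges {M} pm i unmatched =
      count-injection (inComponent? i) (componentEdge? i) edge edge-injective
      where
      rep : comp v ≡ i → ∃ λ e → Allowed G e × Represents M v e
      rep v∈i = representative pm (unmatched v∈i)
      edge : comp v ≡ i → ∃ (ComponentEdge i)
      edge v∈i = let e , a , r = rep v∈i
                 in e , a , trans (allowed⇒same-component a (represents⇒incident r)) v∈i
      edge-injective : (p : comp v ≡ i) (q : comp w ≡ i) → proj₁ (edge p) ≡ proj₁ (edge q) → v ≡ w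
      edge-injective {w = w} p q eq = represents-injective (proj₂ (proj₂ (rep p)))
                                        (subst (Represents M w) (sym eq) (proj₂ (proj₂ (rep q))))

    pendant-component≤1+edges : IsPerfectMatching G M → ∀ {r i} → comp r ≡ i →
                                ¬ ∃ (UnmatchedAllowedAt M r) →
                                count (inComponent? i) ℕ.≤ suc (count (componentEdge? i))
    pendant-component≤1+edges pm {r} {i} r∈i none with matching-edge pm r
    ... | e , e∈M , er = ℕP.≤-trans (sole-allowed-component≤2 r∈i (no-unmatched⇒sole-allowed pm none (e∈M , er)) er)
                                    (s≤s 1≤edges)
      where
      e-in-i : ComponentEdge i e
      e-in-i = (_ , pm , e∈M) , trans (allowed⇒same-component (_ , pm , e∈M) er) r∈i
      1≤edges : 1 ℕ.≤ count (componentEdge? i)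
      1≤edges = subst (1 ℕ.≤_) (sym (count-remove (componentEdge? i) e-in-i)) (s≤s z≤n)

    component≤1+edges : HasPerfectMatching G → ∀ i →
                        count (inComponent? i) ℕ.≤ suc (count (componentEdge? i))
    component≤1+edges (M , pm) i
      with any? (λ r → inComponent? i r ×-dec ¬? (any? (unmatchedAllowedAt? M r)))
    ... | yes (r , r∈i , none) = pendant-component≤1+edges pm r∈i none
    ... | no no-pendant = ℕP.≤-trans (component≤edges pm i unmatched) (ℕP.n≤1+n _)
      where
      unmatched : ∀ {v} → comp v ≡ i → ∃ (UnmatchedAllowedAt M v)
      unmatched {v} v∈i = decidable-stable (any? (unmatchedAllowedAt? M v))
                                           (λ none → no-pendant (v , v∈i , none))

    module _ (Φ : Fin m → ℕ) where
      -- An edge is attributed to the component of its left endpoint, as in ΦK, which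
      -- unfolds to  componentWeight i - componentSize i + + 2.
      componentWeight : Fin k → ℤ
      componentWeight i =
        ∑ m (λ e → if allowed G e then (if ⌊ comp (left e) ≟ᶠ i ⌋ then + Φ e else 0ℤ) else 0ℤ)

      componentSize : Fin k → ℤ
      componentSize i = ∑ n (λ v → if ⌊ comp v ≟ᶠ i ⌋ then 1ℤ else 0ℤ)

      count≤componentWeight : (∀ e → 0 < Φ e) → ∀ i → + count (componentEdge? i) ≤ componentWeight i
      count≤componentWeight Φ>0 i = subst (_≤ componentWeight i) (∑-iverson≡count m (componentEdge? i))
        (∑-mono-≤ m λ e → subst (iverson (componentEdge? i e) ≤_)
                               (sym (if-⌊×-dec⌋ (allowed? G e) (comp (left e) ≟ᶠ i) (+ Φ e) 0ℤ))
                               (iverson≤ (componentEdge? i e) (+≤+ (Φ>0 e))))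

      ΦK≥1 : HasPerfectMatching G → (∀ e → 0 < Φ e) → ∀ i → 1ℤ ≤ ΦK G Φ comp i
      ΦK≥1 hasPM Φ>0 i = 1≤x-y+2 {componentWeight i}
        (ℤP.≤-trans size≤1+count (ℤP.+-monoʳ-≤ 1ℤ (count≤componentWeight Φ>0 i)))
        where
        size≤1+count : componentSize i ≤ 1ℤ + + count (componentEdge? i)
        size≤1+count = subst (_≤ 1ℤ + + count (componentEdge? i)) (sym (∑-iverson≡count n (inComponent? i)))
                             (+≤+ (component≤1+edges hasPM i))

      ∑-componentWeight : ∑ k componentWeight ≡ ΦE G Φ
      ∑-componentWeight = trans (∑-comm k m _)
        (∑-cong m (λ e → ∑-guarded-δ k (allowed G e) (comp (left e)) (+ Φ e)))

      ∑-componentSize : ∑ k componentSize ≡ + n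
      ∑-componentSize = trans (∑-comm k n _) (trans (∑-cong n (λ v → ∑-δ k (comp v) 1ℤ)) (∑-one n))

      ∑ΦK-1≡ΦE-n+k : ∑ k (λ i → ΦK G Φ comp i - 1ℤ) ≡ ΦE G Φ - + n + + k
      ∑ΦK-1≡ΦE-n+k = begin
        ∑ k (λ i → ΦK G Φ comp i - 1ℤ)           ≡⟨ ∑-cong k (λ i → drop-one (W i) (V i)) ⟩
        ∑ k (λ i → (W i - V i) + 1ℤ)             ≡⟨ ∑-distrib-+ k (λ i → W i - V i) (λ _ → 1ℤ) ⟩
        ∑ k (λ i → W i - V i) + ∑ k (λ _ → 1ℤ)   ≡⟨ cong₂ _+_ (∑-distrib-+ k W (λ i → - V i)) (∑-one k) ⟩
        ∑ k W + ∑ k (λ i → - V i) + + k          ≡⟨ cong (λ s → ∑ k W + s + + k) (∑-neg k V) ⟩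
        ∑ k W - ∑ k V + + k                      ≡⟨ cong₂ (λ w s → w - s + + k) ∑-componentWeight ∑-componentSize ⟩
        ΦE G Φ - + n + + k                       ∎
        where
        open ≡-Reasoning
        W = componentWeight
        V = componentSize
        drop-one : ∀ w s → w - s + + 2 - 1ℤ ≡ (w - s) + 1ℤ
        drop-one = solve-∀

lemma5 : {n m : ℕ} (G : BipGraph n m) → HasPerfectMatching G →
         (Φ : Fin m → ℕ) → (∀ e → 0 < Φ e) →
         (k : ℕ) (comp : Fin n → Fin k) → Components G k comp →
         ΦE G Φ - + n + + k + + 1 ≤ ΦG G Φ k comp
lemma5 G hasPM Φ Φ>0 k comp C =
  subst (λ s → s + 1ℤ ≤ ΦG G Φ k comp) (∑ΦK-1≡ΦE-n+k G C Φ)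
        (∑-pred≤∏ k (ΦK G Φ comp) (ΦK≥1 G C Φ hasPM Φ>0))
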